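{- Let $\mathcal{A}$ be a trim NFA. Then $\widehat L(\mathcal{A})=\bigcup_{\pi\text{ accepting}} L(\pi)$, where the union ranges over all accepting SCC-paths $\pi$ of $\mathcal{A}$.
   Context: $\mathcal{A}=(Q,\Sigma,\delta,q_0,F)$ trim NFA. SCC = maximal set of mutually reachable states; $s<_{\mathcal{A}}t$ if the SCC of $t$ is reachable from that of $s$ and they are different. $p$ = lcm of lengths of all simple cycles of $\mathcal{A}$. A positional word is a word over $(\mathbb{Z}/p\mathbb{Z})\times\Sigma$ of the form $(n\bmod p,a_0)((n+1)\bmod p,a_1)\cdots$, written $\langle n:u\rangle$ with $u=a_0a_1\cdots$. $\widehat L(\mathcal{A})=\{\langle 0:u\rangle: u\in L(\mathcal{A})\}$. A portal is $P=(s,x,t,y)\in(Q\times\mathbb{Z}/p\mathbb{Z})^2$ with $s,t$ in the same SCC; $L(P)=\{\langle x:w\rangle: s\xrightarrow{w}t,\ x+|w|\equiv y\pmod p\}$. An SCC-path is $\pi=P_0\xrightarrow{a_1}P_1\cdots\xrightarrow{a_k}P_k$ with portals $P_i=(s_i,x_i,t_i,y_i)$, letters $a_i\in\Sigma$, $x_i\equiv y_{i-1}+1\pmod p$, $s_i\in\delta(t_{i-1},a_i)$ and $t_{i-1}<_{\mathcal{A}}s_i$; its language is $L(\pi)=L(P_0)(y_0,a_1)L(P_1)\cdots(y_{k-1},a_k)L(P_k)$. It is accepting if $x_0=0$, $s_0=q_0$, $t_k\in F$ and $L(\pi)\neq\emptyset$. -}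

module Defs where

open import Data.Nat using (ℕ; zero; suc; _+_; NonZero)
open import Data.Nat.Divisibility using (_∣_)
open import Data.Unit using (⊤)
open import Data.Nat.DivMod using (_mod_)
open import Data.Fin using (Fin; toℕ)
open import Data.Fin.Subset using (Subset; _∈_)
open import Data.List using (List; []; _∷_; _++_; length; [_])
open import Data.List.Relation.Unary.Unique.Propositional using (Unique)
open import Data.Product using (Σ; ∃; ∃-syntax; _×_; _,_)
open import Relation.Binary.PropositionalEquality using (_≡_)
open import Relation.Nullary using (¬_)

record NFA (n m : ℕ) : Set where
  field
    δ  : Fin n → Fin m → Subset n
    q₀ : Fin n
    F  : Subset n

module _ {n m : ℕ} (A : NFA n m) where
  open NFA A

  data Run : Fin n → List (Fin m) → Fin n → Set where
    nil  : ∀ {s} → Run s [] s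
    cons : ∀ {s a t w u} → t ∈ δ s a → Run t w u → Run s (a ∷ w) u

  Reach : Fin n → Fin n → Set
  Reach s t = ∃[ w ] Run s w t

  Lang : List (Fin m) → Set
  Lang u = ∃[ t ] (t ∈ F × Run q₀ u t)

  Trim : Set
  Trim = ∀ q → Reach q₀ q × ∃[ f ] (f ∈ F × Reach q f)

  SameSCC : Fin n → Fin n → Set
  SameSCC s t = Reach s t × Reach t s

  _<A_ : Fin n → Fin n → Set
  s <A t = Reach s t × ¬ SameSCC s t

  Edge : Fin n → Fin n → Set
  Edge s t = ∃[ a ] (t ∈ δ s a)

  Chain : List (Fin n) → Set
  Chain []           = ⊤
  Chain (q ∷ [])     = ⊤
  Chain (q ∷ r ∷ qs) = Edge q r × Chain (r ∷ qs)

  SimpleCycle : Fin n → List (Fin n) → Set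
  SimpleCycle q qs = Unique (q ∷ qs) × Chain (q ∷ qs ++ [ q ])

  IsCycleLcm : ℕ → Set
  IsCycleLcm p =
    (∀ q qs → SimpleCycle q qs → suc (length qs) ∣ p) ×
    (∀ d → (∀ q qs → SimpleCycle q qs → suc (length qs) ∣ d) → p ∣ d)

  module Positional (p : ℕ) .{{_ : NonZero p}} where

    PLetter : Set
    PLetter = Fin p × Fin m

    pos : ℕ → List (Fin m) → List PLetter
    pos k []      = []
    pos k (a ∷ u) = (k mod p , a) ∷ pos (suc k) u

    LangHat : List PLetter → Set
    LangHat v = ∃[ u ] (Lang u × v ≡ pos 0 u)

    record Portal : Set where
      constructor portal
      field
        s : Fin n
        x : Fin p
        t : Fin n
        y : Fin p

    IsPortal : Portal → Set
    IsPortal (portal s x t y) = SameSCC s t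

    LPortal : Portal → List PLetter → Set
    LPortal (portal s x t y) v =
      ∃[ w ] (Run s w t × (toℕ x + length w) mod p ≡ y × v ≡ pos (toℕ x) w)

    data SCCPath : Portal → Portal → Set where
      single : ∀ P → IsPortal P → SCCPath P P
      step   : ∀ {P₀ P} → SCCPath P₀ P → (a : Fin m) → (P' : Portal) →
               IsPortal P' →
               Portal.x P' ≡ (toℕ (Portal.y P) + 1) mod p →
               Portal.s P' ∈ δ (Portal.t P) a →
               Portal.t P <A Portal.s P' →
               SCCPath P₀ P'

    LPath : ∀ {P₀ P} → SCCPath P₀ P → List PLetter → Set
    LPath (single P _) v = LPortal P v
    LPath (step {P = P} π a P' _ _ _ _) v =
      ∃[ v₁ ] ∃[ v₂ ] (LPath π v₁ × LPortal P' v₂ ×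
                       v ≡ v₁ ++ (Portal.y P , a) ∷ v₂)

    Accepting : ∀ {P₀ P} → SCCPath P₀ P → Set
    Accepting {P₀} {P} π =
      toℕ (Portal.x P₀) ≡ 0 × Portal.s P₀ ≡ q₀ × Portal.t P ∈ F ×
      ∃[ v ] LPath π v

-- A run of the automaton visits the SCCs in strictly increasing order. Cutting the
-- positional word of an accepting run at the transitions that leave an SCC splits it
-- into portal languages joined by single letters, i.e. into the language of an accepting
-- SCC-path; conversely the runs witnessing the portals of a path glue, along the
-- connecting transitions, into one accepting run. Locating the cuts requires deciding
-- reachability, which holds because every reachable state is reachable by a loop-free
-- run, and such a run is shorter than the number of states by the pigeonhole principle.
module Submission where

open import Defs
open import Data.Nat using (ℕ; NonZero; >-nonZero⁻¹; suc; _+_; _<_; _%_; z≤n; s≤s)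
open import Data.Nat.Properties using (+-comm; +-assoc; +-suc; +-identityʳ)
open import Data.Nat.DivMod using (_mod_; m%n<n; m%n%n≡m%n; %-distribˡ-+; m<n⇒m%n≡m)
open import Data.Fin using (Fin; toℕ)
open import Data.Fin.Properties
  using (toℕ-fromℕ<; fromℕ<-cong; fromℕ<-toℕ; toℕ<n; injective⇒≤; any?; _≟_)
open import Data.Fin.Subset using (_∈_)
open import Data.Fin.Subset.Properties using (_∈?_)
open import Data.List using (List; []; _∷_; _++_; length; [_])
open import Data.List.Properties using (length-++; ++-assoc; ++-identityʳ)
open import Data.Vec using (Vec; _∷_; [])
open import Data.Vec.Relation.Unary.All using ([]; decide)
open import Data.Vec.Relation.Unary.Any using (here; there)
open import Data.Vec.Relation.Unary.Unique.Propositional using (Unique; []; _∷_)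
open import Data.Vec.Relation.Unary.Unique.Propositional.Properties using (lookup-injective)
open import Data.Vec.Membership.Propositional using () renaming (_∈_ to _∈ᵥ_)
open import Data.Product using (Σ; ∃-syntax; _×_; _,_; proj₁; proj₂)
open import Data.Sum using (_⊎_; inj₁; inj₂; swap)
open import Function using (_∘_)
open import Function.Bundles using (_⇔_; mk⇔)
open import Relation.Binary.PropositionalEquality
  using (_≡_; refl; sym; trans; cong; cong₂; subst; module ≡-Reasoning)
open import Relation.Nullary using (Dec; yes; no)
open import Relation.Nullary.Decidable using (map′; toSum; _×-dec_; _⊎-dec_)

module Residues (p : ℕ) .{{_ : NonZero p}} where

  next : Fin p → Fin p
  next y = (toℕ y + 1) mod p

  toℕ-mod : ∀ k → toℕ (k mod p) ≡ k % p
  toℕ-mod k = toℕ-fromℕ< (m%n<n k p)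

  toℕ-0-mod : toℕ (0 mod p) ≡ 0
  toℕ-0-mod = trans (toℕ-mod 0) (m<n⇒m%n≡m (>-nonZero⁻¹ p))

  mod-toℕ : (i : Fin p) → toℕ i mod p ≡ i
  mod-toℕ i = trans (fromℕ<-cong _ _ (m<n⇒m%n≡m i<p) _ i<p) (fromℕ<-toℕ i i<p)
    where
    i<p : toℕ i < p
    i<p = toℕ<n i

  toℕ-mod-+ : ∀ k l → (toℕ (k mod p) + l) mod p ≡ (k + l) mod p
  toℕ-mod-+ k l = fromℕ<-cong _ _ %-eq _ _
    where
    open ≡-Reasoning
    %-eq : (toℕ (k mod p) + l) % p ≡ (k + l) % p
    %-eq = begin
      (toℕ (k mod p) + l) % p   ≡⟨ cong (λ j → (j + l) % p) (toℕ-mod k) ⟩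
      (k % p + l) % p           ≡⟨ %-distribˡ-+ (k % p) l p ⟩
      (k % p % p + l % p) % p   ≡⟨ cong (λ j → (j + l % p) % p) (m%n%n≡m%n k p) ⟩
      (k % p + l % p) % p       ≡⟨ %-distribˡ-+ k l p ⟨
      (k + l) % p               ∎

  suc-mod : ∀ k → suc k mod p ≡ next (k mod p)
  suc-mod k = trans (cong (_mod p) (+-comm 1 k)) (sym (toℕ-mod-+ k 1))

  next-mod-+ : ∀ k l → (toℕ (next (k mod p)) + l) mod p ≡ (suc k + l) mod p
  next-mod-+ k l =
    trans (cong (λ i → (toℕ i + l) mod p) (sym (suc-mod k))) (toℕ-mod-+ (suc k) l)

module _ {n m : ℕ} (A : NFA n m) where
  open NFA A

  private variable
    a : Fin m
    q s t u : Fin n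
    w w' : List (Fin m)

  Run-++ : Run A s w t → Run A t w' u → Run A s (w ++ w') u
  Run-++ nil        r' = r'
  Run-++ (cons e r) r' = cons e (Run-++ r r')

  Reach-trans : Reach A s t → Reach A t u → Reach A s u
  Reach-trans (w , r) (w' , r') = w ++ w' , Run-++ r r'

  Reach-edge : t ∈ δ s a → Reach A s t
  Reach-edge {a = a} e = [ a ] , cons e nil

  SameSCC-refl : SameSCC A s s
  SameSCC-refl = ([] , nil) , ([] , nil)

  states : Run A s w t → Vec (Fin n) (suc (length w))
  states {s = s} nil        = s ∷ []
  states {s = s} (cons e r) = s ∷ states r

  LoopFreeRun : Fin n → Fin n → Set
  LoopFreeRun s t = ∃[ w ] Σ (Run A s w t) (Unique ∘ states)

  loopFree-suffix : (r : Run A s w t) → Unique (states r) → q ∈ᵥ states r →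
                    LoopFreeRun q t
  loopFree-suffix nil        u       (here refl) = _ , nil , u
  loopFree-suffix (cons e r) u       (here refl) = _ , cons e r , u
  loopFree-suffix (cons e r) (_ ∷ u) (there q∈)  = loopFree-suffix r u q∈

  loopFree : Run A s w t → LoopFreeRun s t
  loopFree nil = _ , nil , [] ∷ []
  loopFree {s = s} (cons e r) with loopFree r
  ... | _ , r' , u with decide (swap ∘ toSum ∘ (s ≟_)) (states r')
  ...   | inj₁ s∉ = _ , cons e r' , s∉ ∷ u
  ...   | inj₂ s∈ = loopFree-suffix r' u s∈

  loopFree-length : (r : Run A s w t) → Unique (states r) → length w < n
  loopFree-length r u = injective⇒≤ (lookup-injective u _ _)

  ReachWithin : ℕ → Fin n → Fin n → Set
  ReachWithin k s t = ∃[ w ] (length w < k × Run A s w t)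

  reachWithin? : ∀ k s t → Dec (ReachWithin k s t)
  reachWithin? 0       s t = no λ ()
  reachWithin? (suc k) s t =
    map′ fromStep toStep
      (s ≟ t ⊎-dec any? λ a → any? λ s' → s' ∈? δ s a ×-dec reachWithin? k s' t)
    where
    Step : Set
    Step = s ≡ t ⊎ ∃[ a ] ∃[ s' ] (s' ∈ δ s a × ReachWithin k s' t)
    fromStep : Step → ReachWithin (suc k) s t
    fromStep (inj₁ refl)                    = [] , s≤s z≤n , nil
    fromStep (inj₂ (a , _ , e , w , lt , r)) = a ∷ w , s≤s lt , cons e r
    toStep : ReachWithin (suc k) s t → Step
    toStep ([]    , _      , nil)      = inj₁ refl
    toStep (a ∷ w , s≤s lt , cons e r) = inj₂ (a , _ , e , w , lt , r)

  reach? : ∀ s t → Dec (Reach A s t)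
  reach? s t = map′ (λ (w , _ , r) → w , r) shorten (reachWithin? n s t)
    where
    shorten : Reach A s t → ReachWithin n s t
    shorten (_ , r) = let (w , r' , u) = loopFree r in w , loopFree-length r' u , r'

module _ {n m : ℕ} (A : NFA n m) (p : ℕ) .{{_ : NonZero p}} where
  open NFA A
  open Positional A p
  open Residues p

  private variable
    a : Fin m
    s s₀ t t' u : Fin n
    k : ℕ
    x x₀ y z : Fin p
    v v₁ v₂ : List PLetter
    w : List (Fin m)
    P₀ P : Portal

  pos-++ : ∀ k w w' → pos k (w ++ w') ≡ pos k w ++ pos (k + length w) w'
  pos-++ k []      w' = cong (λ j → pos j w') (sym (+-identityʳ k))
  pos-++ k (a ∷ w) w' =
    cong (_ ∷_) (trans (pos-++ (suc k) w w')
                       (cong (λ j → pos (suc k) w ++ pos j w') (sym (+-suc k _))))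

  pos-cong : ∀ {k k'} w → k mod p ≡ k' mod p → pos k w ≡ pos k' w
  pos-cong []      eq = refl
  pos-cong {k} {k'} (a ∷ w) eq = cong₂ _∷_ (cong (_, a) eq) (pos-cong w suc-eq)
    where
    suc-eq : suc k mod p ≡ suc k' mod p
    suc-eq = trans (suc-mod k) (trans (cong next eq) (sym (suc-mod k')))

  pos-next : ∀ k w → pos (toℕ (next (k mod p))) w ≡ pos (suc k) w
  pos-next k w = pos-cong w (trans (mod-toℕ _) (sym (suc-mod k)))

  LPortal-[] : ∀ s y → LPortal (portal s y s y) []
  LPortal-[] s y = [] , nil , trans (cong (_mod p) (+-identityʳ (toℕ y))) (mod-toℕ y) , refl

  LPortal-glue : LPortal (portal s x t y) v₁ → t' ∈ δ t a →
                 LPortal (portal t' (next y) u z) v₂ →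
                 LPortal (portal s x u z) (v₁ ++ (y , a) ∷ v₂)
  LPortal-glue {x = x} {a = a} (w₁ , r₁ , refl , refl) e (w₂ , r₂ , refl , refl) =
    w₁ ++ a ∷ w₂ , Run-++ A r₁ (cons e r₂) , position , word
    where
    X K : ℕ
    X = toℕ x
    K = X + length w₁
    length-eq : X + length (w₁ ++ a ∷ w₂) ≡ suc K + length w₂
    length-eq = trans (cong (X +_) (length-++ w₁)) (trans (sym (+-assoc X _ _)) (+-suc K _))
    position : (X + length (w₁ ++ a ∷ w₂)) mod p ≡
               (toℕ (next (K mod p)) + length w₂) mod p
    position = trans (cong (_mod p) length-eq) (sym (next-mod-+ K (length w₂)))
    word : pos X w₁ ++ (K mod p , a) ∷ pos (toℕ (next (K mod p))) w₂ ≡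
           pos X (w₁ ++ a ∷ w₂)
    word = trans (cong (λ v → pos X w₁ ++ (K mod p , a) ∷ v) (pos-next K w₂))
                 (sym (pos-++ X w₁ (a ∷ w₂)))

  LPortal-snoc : LPortal (portal s x t y) v → t' ∈ δ t a →
                 LPortal (portal s x t' (next y)) (v ++ [ (y , a) ])
  LPortal-snoc lp e = LPortal-glue lp e (LPortal-[] _ _)

  LPath⇒LPortal : (π : SCCPath P₀ P) → LPath π v →
                  LPortal (portal (Portal.s P₀) (Portal.x P₀) (Portal.t P) (Portal.y P)) v
  LPath⇒LPortal (single _ _)                           lp                         = lp
  LPath⇒LPortal (step π _ (portal _ _ _ _) _ refl e _) (_ , _ , lp , lq , refl) =
    LPortal-glue (LPath⇒LPortal π lp) e lq

  lastPortal-SameSCC : SCCPath P₀ P → IsPortal P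
  lastPortal-SameSCC (single _ ss)         = ss
  lastPortal-SameSCC (step _ _ _ ss _ _ _) = ss

  -- The exit of the first portal is left open: it moves when a one-portal path is extended.
  LPaths : Fin n → Fin p → Fin n → Fin p → List PLetter → Set
  LPaths s₀ x₀ t y v =
    ∃[ t₀ ] ∃[ y₀ ] ∃[ s ] ∃[ x ]
      Σ (SCCPath (portal s₀ x₀ t₀ y₀) (portal s x t y)) (λ π → LPath π v)

  LPaths-[] : ∀ s x → LPaths s x s x []
  LPaths-[] s x = _ , _ , _ , _ , single _ (SameSCC-refl A) , LPortal-[] s x

  extendLastPortal : ∀ {t₀ y₀} (π : SCCPath (portal s₀ x₀ t₀ y₀) (portal s x t y)) →
                     LPath π v → t' ∈ δ t a → SameSCC A s t' →
                     LPaths s₀ x₀ t' (next y) (v ++ [ (y , a) ])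
  extendLastPortal (single _ _) lp e ss = _ , _ , _ , _ , single _ ss , LPortal-snoc lp e
  extendLastPortal (step π b _ _ x≡ e′ lt) (v₁ , v₂ , lp , lq , refl) e ss =
    _ , _ , _ , _ , step π b _ ss x≡ e′ lt ,
    v₁ , _ , lp , LPortal-snoc lq e , ++-assoc v₁ _ _

  LPaths-snoc : LPaths s₀ x₀ t y v → t' ∈ δ t a →
                LPaths s₀ x₀ t' (next y) (v ++ [ (y , a) ])
  LPaths-snoc {t = t} {t' = t'} (_ , _ , s , _ , π , lp) e with reach? A t' s
  ... | yes t'↝s = extendLastPortal π lp e (Reach-trans A s↝t (Reach-edge A e) , t'↝s)
    where
    s↝t : Reach A s t
    s↝t = proj₁ (lastPortal-SameSCC π)
  ... | no t'↛s  =
    _ , _ , _ , _ , step π _ (portal t' _ t' _) (SameSCC-refl A) refl e t<t' ,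
    _ , [] , lp , LPortal-[] _ _ , refl
    where
    t<t' : _<A_ A t t'
    t<t' = Reach-edge A e ,
           λ (_ , t'↝t) → t'↛s (Reach-trans A t'↝t (proj₂ (lastPortal-SameSCC π)))

  LPaths-run : LPaths s₀ x₀ t y v → k mod p ≡ y → Run A t w u →
               ∃[ z ] LPaths s₀ x₀ u z (v ++ pos k w)
  LPaths-run {v = v} ps refl nil = _ , subst (LPaths _ _ _ _) (sym (++-identityʳ v)) ps
  LPaths-run {v = v} {k = k} ps refl (cons {a = a} {w = w} e r) =
    subst (λ v' → ∃[ z ] LPaths _ _ _ z v') (++-assoc v [ (k mod p , a) ] (pos (suc k) w))
      (LPaths-run (LPaths-snoc ps e) (suc-mod k) r)

  AcceptingLang : List PLetter → Set
  AcceptingLang v = ∃[ P₀ ] ∃[ P ] ∃[ π ] (Accepting {P₀} {P} π × LPath π v)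

  LangHat⇒AcceptingLang : LangHat v → AcceptingLang v
  LangHat⇒AcceptingLang (u , (f , f∈F , r) , refl) =
    let (_ , _ , _ , _ , _ , π , lp) = LPaths-run (LPaths-[] q₀ (0 mod p)) refl r
    in  _ , _ , π , (toℕ-0-mod , refl , f∈F , _ , lp) , lp

  AcceptingLang⇒LangHat : AcceptingLang v → LangHat v
  AcceptingLang⇒LangHat (_ , P , π , (x₀≡0 , refl , t∈F , _) , lp) with LPath⇒LPortal π lp
  ... | w , r , _ , refl = w , (Portal.t P , t∈F , r) , cong (λ k → pos k w) x₀≡0

lemma41 : ∀ {n m} (A : NFA n m) → Trim A →
    (p : ℕ) .{{_ : NonZero p}} → IsCycleLcm A p →
    (v : List (Positional.PLetter A p)) →
    Positional.LangHat A p v ⇔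
      (∃[ P₀ ] ∃[ P ] ∃[ π ] (Positional.Accepting A p {P₀} {P} π × Positional.LPath A p π v))
lemma41 A _ p _ v = mk⇔ (LangHat⇒AcceptingLang A p) (AcceptingLang⇒LangHat A p)
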